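{- Let $G$ be a graph and $uv \in E(G)$. If there exist distinct vertices of $G$, one of the two endpoints of the edge playing the role of $u$ and the other the role of $v$, that realize one of the configurations $\mathcal{F}_1, \dots, \mathcal{F}_6$ below (as adjacencies in $G$ among these vertices), then $uv$ is necessary.
   Context: Graphs are finite, simple, connected and labeled. $T_3(G)$ is the set of 3-element subsets of $V(G)$ inducing a connected subgraph of $G$. An edge $uv \in E(G)$ is necessary if there is no graph $H$ (on the same vertex set) with $uv \notin E(H)$ and $T_3(H) = T_3(G)$. The configurations (each requires the edge $uv$; "arbitrary" means that pair may or may not be adjacent; all other listed pairs are required adjacent or non-adjacent as stated): $\mathcal{F}_1$: vertices $u,v,v_1,v_2$; edges $uv_1, vv_2$; non-edges $vv_1, v_1v_2$; $uv_2$ arbitrary. $\mathcal{F}_2$: vertices $u,v,v_1,v_2$; edges $vv_1, vv_2$; non-edges $uv_1, uv_2$; $v_1v_2$ arbitrary. $\mathcal{F}_3$: vertices $u,v,v_1,v_2,v_3$; edges $uv_2, vv_3, v_2v_3, v_1v_2$; non-edges $vv_2, uv_1, vv_1, v_1v_3$; $uv_3$ arbitrary. $\mathcal{F}_4$: vertices $u,v,v_1,v_2,v_3$; edges $vv_1, v_1v_2, v_1v_3$; non-edges $uv_1, uv_2, uv_3, vv_2, vv_3$; $v_2v_3$ arbitrary. $\mathcal{F}_5$: vertices $u,v,v_1,v_2,v_3$ inducing the path $v\,u\,v_3\,v_2\,v_1$ (edges $uv, uv_3, v_3v_2, v_2v_1$ and no other edges among them). $\mathcal{F}_6$: vertices $u,v,v_1,v_2,v_3$;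 edges $uv_1, vv_3, v_1v_2, v_2v_3$; non-edges $vv_1, uv_3, uv_2, vv_2$; $v_1v_3$ arbitrary (so the five vertices induce the 5-cycle $u\,v\,v_3\,v_2\,v_1$, possibly with the chord $v_1v_3$). -}

module Defs where

open import Data.Nat using (ℕ)
open import Data.Fin using (Fin)
open import Data.Bool using (Bool; true; false; _∧_; _∨_)
open import Data.Product using (Σ; _×_; _,_; ∃-syntax)
open import Data.Sum using (_⊎_)
open import Relation.Binary.PropositionalEquality using (_≡_; _≢_)
open import Relation.Nullary using (¬_)

data Reach {n : ℕ} (adj : Fin n → Fin n → Bool) (x : Fin n) : Fin n → Set where
  here : Reach adj x x
  step : ∀ {y z} → Reach adj x y → adj y z ≡ true → Reach adj x z

record Graph (n : ℕ) : Set where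
  field
    adj    : Fin n → Fin n → Bool
    sym    : ∀ x y → adj x y ≡ adj y x
    irrefl : ∀ x → adj x x ≡ false
    conn   : ∀ x y → Reach adj x y

open Graph public

E : ∀ {n} → Graph n → Fin n → Fin n → Set
E G x y = adj G x y ≡ true

NE : ∀ {n} → Graph n → Fin n → Fin n → Set
NE G x y = adj G x y ≡ false

-- {a,b,c} induces a connected subgraph: every pair of the three vertices
-- is joined by a path inside {a,b,c} (directly or via the third vertex).
conn3 : ∀ {n} → Graph n → Fin n → Fin n → Fin n → Bool
conn3 G a b c =
  (adj G a b ∨ (adj G a c ∧ adj G c b)) ∧
  ((adj G a c ∨ (adj G a b ∧ adj G b c)) ∧
   (adj G b c ∨ (adj G b a ∧ adj G a c)))

Distinct3 : ∀ {n} → Fin n → Fin n → Fin n → Set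
Distinct3 a b c = (a ≢ b) × (a ≢ c) × (b ≢ c)

-- T_3(G) = T_3(H): every 3-element subset {a,b,c} lies in T_3(G) iff in T_3(H)
SameT3 : ∀ {n} → Graph n → Graph n → Set
SameT3 {n} G H = ∀ (a b c : Fin n) → Distinct3 a b c → conn3 G a b c ≡ conn3 H a b c

Necessary : ∀ {n} → Graph n → Fin n → Fin n → Set
Necessary {n} G u v = ¬ (Σ (Graph n) λ H → NE H u v × SameT3 G H)

Distinct4 : ∀ {n} → Fin n → Fin n → Fin n → Fin n → Set
Distinct4 a b c d = Distinct3 a b c × (a ≢ d) × (b ≢ d) × (c ≢ d)

Distinct5 : ∀ {n} → Fin n → Fin n → Fin n → Fin n → Fin n → Set
Distinct5 a b c d e = Distinct4 a b c d × (a ≢ e) × (b ≢ e) × (c ≢ e) × (d ≢ e)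

-- Configurations (the edge uv itself is assumed separately).
F1 : ∀ {n} → Graph n → Fin n → Fin n → Set
F1 {n} G u v = ∃[ v1 ] ∃[ v2 ] Distinct4 u v v1 v2 ×
  E G u v1 × E G v v2 × NE G v v1 × NE G v1 v2

F2 : ∀ {n} → Graph n → Fin n → Fin n → Set
F2 {n} G u v = ∃[ v1 ] ∃[ v2 ] Distinct4 u v v1 v2 ×
  E G v v1 × E G v v2 × NE G u v1 × NE G u v2

F3 : ∀ {n} → Graph n → Fin n → Fin n → Set
F3 {n} G u v = ∃[ v1 ] ∃[ v2 ] ∃[ v3 ] Distinct5 u v v1 v2 v3 ×
  E G u v2 × E G v v3 × E G v2 v3 × E G v1 v2 ×
  NE G v v2 × NE G u v1 × NE G v v1 × NE G v1 v3

F4 : ∀ {n} → Graph n → Fin n → Fin n → Set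
F4 {n} G u v = ∃[ v1 ] ∃[ v2 ] ∃[ v3 ] Distinct5 u v v1 v2 v3 ×
  E G v v1 × E G v1 v2 × E G v1 v3 ×
  NE G u v1 × NE G u v2 × NE G u v3 × NE G v v2 × NE G v v3

-- induced path v u v3 v2 v1
F5 : ∀ {n} → Graph n → Fin n → Fin n → Set
F5 {n} G u v = ∃[ v1 ] ∃[ v2 ] ∃[ v3 ] Distinct5 u v v1 v2 v3 ×
  E G u v3 × E G v3 v2 × E G v2 v1 ×
  NE G u v1 × NE G u v2 × NE G v v1 × NE G v v2 × NE G v v3 × NE G v1 v3

F6 : ∀ {n} → Graph n → Fin n → Fin n → Set
F6 {n} G u v = ∃[ v1 ] ∃[ v2 ] ∃[ v3 ] Distinct5 u v v1 v2 v3 ×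
  E G u v1 × E G v v3 × E G v1 v2 × E G v2 v3 ×
  NE G v v1 × NE G u v3 × NE G u v2 × NE G v v2

Config : ∀ {n} → Graph n → Fin n → Fin n → Set
Config G u v = F1 G u v ⊎ F2 G u v ⊎ F3 G u v ⊎ F4 G u v ⊎ F5 G u v ⊎ F6 G u v

{-# OPTIONS --safe #-}
module Submission where

-- A 3-set is connected iff at least two of its three pairs are edges.  Hence,
-- in a graph H with T₃(H) = T₃(G), a triple that is connected in G and misses
-- one of its pairs in H must contain the other two pairs in H, and a triple
-- that is disconnected in G and contains one pair in H misses the other two.
-- Starting from the assumption that H misses uv, each configuration lets these
-- two rules propagate until some triple is forced to be connected in exactly
-- one of G and H.

open import Defs
open import Data.Nat using (ℕ)
open import Data.Fin using (Fin)
open import Data.Bool using (Bool; true; false; _∧_; _∨_)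
open import Data.Bool.Properties using (not-¬)
open import Data.Product using (_×_; _,_; proj₁; proj₂)
open import Data.Sum using (_⊎_; [_,_])
open import Data.Empty using (⊥)
open import Function using (_∘_)
open import Relation.Binary.PropositionalEquality
  using (_≡_; refl; trans; ≢-sym; module ≡-Reasoning)
  renaming (sym to ≡-sym)

majority : Bool → Bool → Bool → Bool
majority true  y z = y ∨ z
majority false y z = y ∧ z

majority-true₁₂ : ∀ {x y z} → x ≡ true → y ≡ true → majority x y z ≡ true
majority-true₁₂ refl refl = refl

majority-true₁₃ : ∀ {x y z} → x ≡ true → z ≡ true → majority x y z ≡ true
majority-true₁₃ {y = true}  refl refl = refl
majority-true₁₃ {y = false} refl refl = refl

majority-false₁₂ : ∀ {x y z} → x ≡ false → y ≡ false → majority x y z ≡ false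
majority-false₁₂ refl refl = refl

majority-false₁₃ : ∀ {x y z} → x ≡ false → z ≡ false → majority x y z ≡ false
majority-false₁₃ {y = true}  refl refl = refl
majority-false₁₃ {y = false} refl refl = refl

majority-true-without₁ : ∀ {x y z} → x ≡ false → majority x y z ≡ true → y ≡ true × z ≡ true
majority-true-without₁ {y = true}  {z = true}  refl refl = refl , refl
majority-true-without₁ {y = true}  {z = false} refl ()
majority-true-without₁ {y = false}             refl ()

majority-false-with₁ : ∀ {x y z} → x ≡ true → majority x y z ≡ false → y ≡ false × z ≡ false
majority-false-with₁ {y = false} {z = false} refl refl = refl , refl
majority-false-with₁ {y = false} {z = true}  refl ()
majority-false-with₁ {y = true}              refl ()

majority-∧∨ : ∀ x y z → (x ∨ (y ∧ z)) ∧ ((y ∨ (x ∧ z)) ∧ (z ∨ (x ∧ y))) ≡ majority x y z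
majority-∧∨ true  true  true  = refl
majority-∧∨ true  true  false = refl
majority-∧∨ true  false true  = refl
majority-∧∨ true  false false = refl
majority-∧∨ false true  true  = refl
majority-∧∨ false true  false = refl
majority-∧∨ false false true  = refl
majority-∧∨ false false false = refl

module _ {n : ℕ} where

  adj-comm : (K : Graph n) {a b : Fin n} {x : Bool} → adj K a b ≡ x → adj K b a ≡ x
  adj-comm K {a} {b} = trans (sym K b a)

  atLeastTwoEdges : Graph n → Fin n → Fin n → Fin n → Bool
  atLeastTwoEdges K a b c = majority (adj K a b) (adj K a c) (adj K b c)

  conn3≡atLeastTwoEdges : (K : Graph n) (a b c : Fin n) → conn3 K a b c ≡ atLeastTwoEdges K a b c
  conn3≡atLeastTwoEdges K a b c rewrite sym K c b | sym K b a =
    majority-∧∨ (adj K a b) (adj K a c) (adj K b c)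

  necessary-comm : {G : Graph n} {u v : Fin n} → Necessary G v u → Necessary G u v
  necessary-comm vu-necessary (H , ¬uv , same) = vu-necessary (H , adj-comm H ¬uv , same)

module Forcing {n : ℕ} (G H : Graph n) (same : SameT3 G H) {a b c : Fin n} (abc : Distinct3 a b c) where

  atLeastTwoEdges-preserved : atLeastTwoEdges G a b c ≡ atLeastTwoEdges H a b c
  atLeastTwoEdges-preserved = begin
    atLeastTwoEdges G a b c ≡⟨ conn3≡atLeastTwoEdges G a b c ⟨
    conn3 G a b c           ≡⟨ same a b c abc ⟩
    conn3 H a b c           ≡⟨ conn3≡atLeastTwoEdges H a b c ⟩
    atLeastTwoEdges H a b c ∎
    where open ≡-Reasoning

  edges-forced : atLeastTwoEdges G a b c ≡ true → NE H a b → E H a c × E H b c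
  edges-forced connected ¬ab =
    majority-true-without₁ ¬ab (trans (≡-sym atLeastTwoEdges-preserved) connected)

  non-edges-forced : atLeastTwoEdges G a b c ≡ false → E H a b → NE H a c × NE H b c
  non-edges-forced disconnected ab =
    majority-false-with₁ ab (trans (≡-sym atLeastTwoEdges-preserved) disconnected)

  not-both-non-edges : atLeastTwoEdges G a b c ≡ true → NE H a b → NE H a c → ⊥
  not-both-non-edges connected ¬ab ¬ac = not-¬ (proj₁ (edges-forced connected ¬ab)) ¬ac

  not-both-edges : atLeastTwoEdges G a b c ≡ false → E H a b → E H a c → ⊥
  not-both-edges disconnected ab ac = not-¬ ac (proj₁ (non-edges-forced disconnected ab))

module _ {n : ℕ} (G : Graph n) (u v : Fin n) (uv : E G u v) where

  F1⇒necessary : F1 G u v → Necessary G u v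
  F1⇒necessary (v₁ , v₂ , ((u≢v , u≢v₁ , v≢v₁) , u≢v₂ , v≢v₂ , v₁≢v₂) ,
                uv₁ , vv₂ , ¬vv₁ , ¬v₁v₂) (H , ¬uvᴴ , same) =
    not-both-non-edges (≢-sym u≢v , v≢v₂ , u≢v₂)
      (majority-true₁₂ (adj-comm G uv) vv₂) (adj-comm H ¬uvᴴ) ¬vv₂ᴴ
    where
    open Forcing G H same
    vv₁ᴴ : E H v v₁
    vv₁ᴴ = proj₂ (edges-forced (u≢v , u≢v₁ , v≢v₁) (majority-true₁₂ uv uv₁) ¬uvᴴ)
    ¬vv₂ᴴ : NE H v v₂
    ¬vv₂ᴴ = proj₁ (non-edges-forced (v≢v₁ , v≢v₂ , v₁≢v₂) (majority-false₁₃ ¬vv₁ ¬v₁v₂) vv₁ᴴ)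

  F2⇒necessary : F2 G u v → Necessary G u v
  F2⇒necessary (v₁ , v₂ , ((u≢v , u≢v₁ , v≢v₁) , u≢v₂ , v≢v₂ , v₁≢v₂) ,
                vv₁ , vv₂ , ¬uv₁ , ¬uv₂) (H , ¬uvᴴ , same) =
    not-both-edges (u≢v₁ , u≢v₂ , v₁≢v₂) (majority-false₁₂ ¬uv₁ ¬uv₂) uv₁ᴴ uv₂ᴴ
    where
    open Forcing G H same
    uv₁ᴴ : E H u v₁
    uv₁ᴴ = proj₁ (edges-forced (u≢v , u≢v₁ , v≢v₁) (majority-true₁₃ uv vv₁) ¬uvᴴ)
    uv₂ᴴ : E H u v₂
    uv₂ᴴ = proj₁ (edges-forced (u≢v , u≢v₂ , v≢v₂) (majority-true₁₃ uv vv₂) ¬uvᴴ)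

  F3⇒necessary : F3 G u v → Necessary G u v
  F3⇒necessary (v₁ , v₂ , v₃ , (((u≢v , u≢v₁ , v≢v₁) , u≢v₂ , v≢v₂ , v₁≢v₂) , u≢v₃ , _ , v₁≢v₃ , v₂≢v₃) ,
                uv₂ , _ , v₂v₃ , v₁v₂ , ¬vv₂ , ¬uv₁ , ¬vv₁ , ¬v₁v₃) (H , ¬uvᴴ , same) =
    not-both-edges (≢-sym u≢v₁ , v₁≢v₃ , u≢v₃) (majority-false₁₂ (adj-comm G ¬uv₁) ¬v₁v₃) v₁uᴴ v₁v₃ᴴ
    where
    open Forcing G H same
    vv₂ᴴ : E H v v₂
    vv₂ᴴ = proj₂ (edges-forced (u≢v , u≢v₂ , v≢v₂) (majority-true₁₂ uv uv₂) ¬uvᴴ)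
    ¬v₂v₁ᴴ : NE H v₂ v₁
    ¬v₂v₁ᴴ = proj₂ (non-edges-forced (v≢v₂ , v≢v₁ , ≢-sym v₁≢v₂) (majority-false₁₂ ¬vv₂ ¬vv₁) vv₂ᴴ)
    v₁uᴴ : E H v₁ u
    v₁uᴴ = proj₂ (edges-forced (≢-sym v₁≢v₂ , ≢-sym u≢v₂ , ≢-sym u≢v₁)
                   (majority-true₁₂ (adj-comm G v₁v₂) (adj-comm G uv₂)) ¬v₂v₁ᴴ)
    v₁v₃ᴴ : E H v₁ v₃
    v₁v₃ᴴ = proj₂ (edges-forced (≢-sym v₁≢v₂ , v₂≢v₃ , v₁≢v₃)
                    (majority-true₁₂ (adj-comm G v₁v₂) v₂v₃) ¬v₂v₁ᴴ)

  F4⇒necessary : F4 G u v → Necessary G u v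
  F4⇒necessary (v₁ , v₂ , v₃ , (((u≢v , u≢v₁ , v≢v₁) , u≢v₂ , v≢v₂ , v₁≢v₂) , u≢v₃ , v≢v₃ , v₁≢v₃ , v₂≢v₃) ,
                vv₁ , v₁v₂ , v₁v₃ , ¬uv₁ , ¬uv₂ , ¬uv₃ , ¬vv₂ , ¬vv₃) (H , ¬uvᴴ , same) =
    not-both-edges (v≢v₂ , v≢v₃ , v₂≢v₃) (majority-false₁₂ ¬vv₂ ¬vv₃) (adj-comm H v₂vᴴ) (adj-comm H v₃vᴴ)
    where
    open Forcing G H same
    uv₁ᴴ : E H u v₁
    uv₁ᴴ = proj₁ (edges-forced (u≢v , u≢v₁ , v≢v₁) (majority-true₁₃ uv vv₁) ¬uvᴴ)
    ¬v₁v₂ᴴ : NE H v₁ v₂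
    ¬v₁v₂ᴴ = proj₂ (non-edges-forced (u≢v₁ , u≢v₂ , v₁≢v₂) (majority-false₁₂ ¬uv₁ ¬uv₂) uv₁ᴴ)
    ¬v₁v₃ᴴ : NE H v₁ v₃
    ¬v₁v₃ᴴ = proj₂ (non-edges-forced (u≢v₁ , u≢v₃ , v₁≢v₃) (majority-false₁₂ ¬uv₁ ¬uv₃) uv₁ᴴ)
    v₂vᴴ : E H v₂ v
    v₂vᴴ = proj₂ (edges-forced (v₁≢v₂ , ≢-sym v≢v₁ , ≢-sym v≢v₂)
                   (majority-true₁₂ v₁v₂ (adj-comm G vv₁)) ¬v₁v₂ᴴ)
    v₃vᴴ : E H v₃ v
    v₃vᴴ = proj₂ (edges-forced (v₁≢v₃ , ≢-sym v≢v₁ , ≢-sym v≢v₃)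
                   (majority-true₁₂ v₁v₃ (adj-comm G vv₁)) ¬v₁v₃ᴴ)

  F5⇒necessary : F5 G u v → Necessary G u v
  F5⇒necessary (v₁ , v₂ , v₃ , (((u≢v , u≢v₁ , _) , u≢v₂ , v≢v₂ , v₁≢v₂) , u≢v₃ , v≢v₃ , v₁≢v₃ , v₂≢v₃) ,
                uv₃ , v₃v₂ , v₂v₁ , ¬uv₁ , ¬uv₂ , _ , ¬vv₂ , ¬vv₃ , _) (H , ¬uvᴴ , same) =
    not-both-edges (≢-sym u≢v₂ , ≢-sym v₁≢v₂ , u≢v₁) (majority-false₁₃ (adj-comm G ¬uv₂) ¬uv₁) v₂uᴴ v₂v₁ᴴ
    where
    open Forcing G H same
    vv₃ᴴ : E H v v₃
    vv₃ᴴ = proj₂ (edges-forced (u≢v , u≢v₃ , v≢v₃) (majority-true₁₂ uv uv₃) ¬uvᴴ)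
    ¬v₃v₂ᴴ : NE H v₃ v₂
    ¬v₃v₂ᴴ = proj₂ (non-edges-forced (v≢v₃ , v≢v₂ , ≢-sym v₂≢v₃) (majority-false₁₂ ¬vv₃ ¬vv₂) vv₃ᴴ)
    v₂uᴴ : E H v₂ u
    v₂uᴴ = proj₂ (edges-forced (≢-sym v₂≢v₃ , ≢-sym u≢v₃ , ≢-sym u≢v₂)
                   (majority-true₁₂ v₃v₂ (adj-comm G uv₃)) ¬v₃v₂ᴴ)
    v₂v₁ᴴ : E H v₂ v₁
    v₂v₁ᴴ = proj₂ (edges-forced (≢-sym v₂≢v₃ , ≢-sym v₁≢v₃ , ≢-sym v₁≢v₂)
                    (majority-true₁₃ v₃v₂ v₂v₁) ¬v₃v₂ᴴ)

  F6⇒necessary : F6 G u v → Necessary G u v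
  F6⇒necessary (v₁ , v₂ , v₃ , (((u≢v , u≢v₁ , v≢v₁) , u≢v₂ , v≢v₂ , v₁≢v₂) , u≢v₃ , v≢v₃ , _ , v₂≢v₃) ,
                uv₁ , vv₃ , v₁v₂ , _ , ¬vv₁ , ¬uv₃ , ¬uv₂ , ¬vv₂) (H , ¬uvᴴ , same) =
    not-both-edges (u≢v₂ , u≢v₃ , v₂≢v₃) (majority-false₁₂ ¬uv₂ ¬uv₃) (adj-comm H v₂uᴴ) uv₃ᴴ
    where
    open Forcing G H same
    vv₁ᴴ : E H v v₁
    vv₁ᴴ = proj₂ (edges-forced (u≢v , u≢v₁ , v≢v₁) (majority-true₁₂ uv uv₁) ¬uvᴴ)
    uv₃ᴴ : E H u v₃
    uv₃ᴴ = proj₁ (edges-forced (u≢v , u≢v₃ , v≢v₃) (majority-true₁₃ uv vv₃) ¬uvᴴ)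
    ¬v₁v₂ᴴ : NE H v₁ v₂
    ¬v₁v₂ᴴ = proj₂ (non-edges-forced (v≢v₁ , v≢v₂ , v₁≢v₂) (majority-false₁₂ ¬vv₁ ¬vv₂) vv₁ᴴ)
    v₂uᴴ : E H v₂ u
    v₂uᴴ = proj₂ (edges-forced (v₁≢v₂ , ≢-sym u≢v₁ , ≢-sym u≢v₂)
                   (majority-true₁₂ v₁v₂ (adj-comm G uv₁)) ¬v₁v₂ᴴ)

  config⇒necessary : Config G u v → Necessary G u v
  config⇒necessary =
    [ F1⇒necessary , [ F2⇒necessary , [ F3⇒necessary , [ F4⇒necessary , [ F5⇒necessary , F6⇒necessary ] ] ] ] ]

lemma4p8 : ∀ {n : ℕ} (G : Graph n) (u v : Fin n) →
    E G u v → (Config G u v ⊎ Config G v u) → Necessary G u v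
lemma4p8 G u v uv =
  [ config⇒necessary G u v uv , necessary-comm {G = G} ∘ config⇒necessary G v u (adj-comm G uv) ]
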